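{- Let $d\ge 2$ be an integer. For $j\in\{0,1,\ldots,d-1\}$ let $(a_{j,d}(n))_{n\ge0}$ be the increasing enumeration (indexed from $0$) of the nonnegative integers $k$ such that $s_d(k)\equiv j \pmod d$, where $s_d(k)$ denotes the sum of the base-$d$ digits of $k$. Then for all $n\ge 0$ and all $i,j\in\{0,\ldots,d-1\}$, $$a_{j,d}(a_{i,d}(n)) = d\,a_{i,d}(n)+\overline{(j-i)}_d=\begin{cases} d\,a_{i,d}(n)+j-i & \text{if } j\ge i,\\ d\,a_{i,d}(n)+d+j-i & \text{if } j<i.\end{cases}$$
   Context: For an integer $x$, $\overline{(x)}_d$ denotes the residue of $x$ modulo $d$, i.e. the unique integer in $[0,d-1]$ congruent to $x$ modulo $d$. -}

module Defs where

open import Data.Nat using (ℕ; zero; suc; _+_; _*_; _<_; _≤_; NonZero)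
open import Data.Nat.DivMod using (_/_; _%_)
open import Data.Product using (∃; _×_)
open import Function.Bundles using (_⇔_)
open import Relation.Binary.PropositionalEquality using (_≡_)

-- digit sum with fuel; sd-fuel f d k is correct whenever f ≥ k (each step divides k by d ≥ 2)
sd-fuel : ℕ → (d : ℕ) → .{{NonZero d}} → ℕ → ℕ
sd-fuel zero    d k = 0
sd-fuel (suc f) d zero = 0
sd-fuel (suc f) d k@(suc _) = k % d + sd-fuel f d (k / d)

s : (d : ℕ) → .{{NonZero d}} → ℕ → ℕ
s d k = sd-fuel k d k

IsIncreasingEnumeration : (ℕ → Set) → (ℕ → ℕ) → Set
IsIncreasingEnumeration P a =
  (∀ m n → m < n → a m < a n) × (∀ k → (P k ⇔ ∃ λ n → a n ≡ k))

-- Each block {d·m, …, d·m + d − 1} contains exactly one k with s_d(k) ≡ j (mod d): appending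
-- the digit r < d to m gives s_d(d·m + r) = s_d(m) + r, so r must be (j − s_d(m)) mod d.
-- Listing these block representatives in order of m is an increasing enumeration of the class
-- j, and such an enumeration is unique, so a_{j,d}(m) = d·m + (j − s_d(m)) mod d. For
-- m = a_{i,d}(n) we have s_d(m) ≡ i.
module Submission where

open import Defs
open import Data.Nat using (ℕ; zero; suc; _+_; _*_; _∸_; _<_; _≤_; NonZero; s≤s; _/_; >-nonZero⁻¹)
open import Data.Nat.Properties
open import Data.Nat.DivMod
open import Data.Nat.Divisibility using (∣-refl; m∣m*n)
open import Data.Nat.Induction using (<-rec)
open import Data.Product using (∃; _×_; _,_; proj₁; proj₂)
open import Data.Sum using (inj₁; inj₂)
open import Function.Bundles using (Equivalence; mk⇔)
open import Relation.Binary.PropositionalEquality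

strictMono⇒mono : {f : ℕ → ℕ} → (∀ m n → m < n → f m < f n) → ∀ {m n} → m ≤ n → f m ≤ f n
strictMono⇒mono inc {m} {n} m≤n with m≤n⇒m<n∨m≡n m≤n
... | inj₁ m<n  = <⇒≤ (inc m n m<n)
... | inj₂ refl = ≤-refl

module _ {P : ℕ → Set} {a b : ℕ → ℕ} where

  -- a m = b k for some k; k < m would give b k = a k < a m, so m ≤ k and b m ≤ b k.
  isIncreasingEnumeration-≤ : IsIncreasingEnumeration P a → IsIncreasingEnumeration P b →
                              ∀ m → (∀ {k} → k < m → a k ≡ b k) → b m ≤ a m
  isIncreasingEnumeration-≤ (inc-a , range-a) (inc-b , range-b) m below =
    subst (b m ≤_) bk≡am (strictMono⇒mono inc-b m≤k)
    where
      open Equivalence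
      hit : ∃ λ k → b k ≡ a m
      hit = to (range-b (a m)) (from (range-a (a m)) (m , refl))
      k : ℕ
      k = proj₁ hit
      bk≡am : b k ≡ a m
      bk≡am = proj₂ hit
      m≤k : m ≤ k
      m≤k = ≮⇒≥ λ k<m → <-irrefl (trans (below k<m) bk≡am) (inc-a k m k<m)

isIncreasingEnumeration-unique : {P : ℕ → Set} {a b : ℕ → ℕ} →
  IsIncreasingEnumeration P a → IsIncreasingEnumeration P b → ∀ n → a n ≡ b n
isIncreasingEnumeration-unique ea eb = <-rec _ λ m ih →
  ≤-antisym (isIncreasingEnumeration-≤ eb ea m (λ k<m → sym (ih k<m)))
            (isIncreasingEnumeration-≤ ea eb m ih)

module _ (d : ℕ) .{{_ : NonZero d}} where

  %-+-cong : ∀ {x x′ y y′} → x % d ≡ x′ % d → y % d ≡ y′ % d → (x + y) % d ≡ (x′ + y′) % d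
  %-+-cong {x} {x′} {y} {y′} eqx eqy = begin
    (x + y) % d              ≡⟨ %-distribˡ-+ x y d ⟩
    (x % d + y % d) % d      ≡⟨ cong₂ (λ u v → (u + v) % d) eqx eqy ⟩
    (x′ % d + y′ % d) % d    ≡⟨ %-distribˡ-+ x′ y′ d ⟨
    (x′ + y′) % d            ∎
    where open ≡-Reasoning

  [d∸c%d+[c+x]]%d≡x%d : ∀ c x → (d ∸ c % d + (c + x)) % d ≡ x % d
  [d∸c%d+[c+x]]%d≡x%d c x = begin
    (d ∸ c % d + (c + x)) % d      ≡⟨ cong (_% d) (+-assoc (d ∸ c % d) c x) ⟨
    (d ∸ c % d + c + x) % d        ≡⟨ %-+-cong (%-+-cong {d ∸ c % d} refl (sym (m%n%n≡m%n c d))) refl ⟩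
    (d ∸ c % d + c % d + x) % d    ≡⟨ cong (λ u → (u + x) % d) (m∸n+n≡m (m%n≤n c d)) ⟩
    (d + x) % d                    ≡⟨ %-remove-+ˡ x ∣-refl ⟩
    x % d                          ∎
    where open ≡-Reasoning

  +-cancelˡ-%-< : ∀ c {x y} → x < d → y < d → (c + x) % d ≡ (c + y) % d → x ≡ y
  +-cancelˡ-%-< c {x} {y} x<d y<d eq = begin
    x                          ≡⟨ m<n⇒m%n≡m x<d ⟨
    x % d                      ≡⟨ [d∸c%d+[c+x]]%d≡x%d c x ⟨
    (d ∸ c % d + (c + x)) % d  ≡⟨ %-+-cong {d ∸ c % d} refl eq ⟩
    (d ∸ c % d + (c + y)) % d  ≡⟨ [d∸c%d+[c+x]]%d≡x%d c y ⟩
    y % d                      ≡⟨ m<n⇒m%n≡m y<d ⟩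
    y                          ∎
    where open ≡-Reasoning

  -- (j − c) mod d; adding d first keeps the truncated subtraction exact.
  modDiff : ℕ → ℕ → ℕ
  modDiff j c = (d + j ∸ c % d) % d

  modDiff<d : ∀ j c → modDiff j c < d
  modDiff<d j c = m%n<n _ d

  +-modDiff-% : ∀ {j} c → j < d → (c + modDiff j c) % d ≡ j
  +-modDiff-% {j} c j<d = begin
    (c + modDiff j c) % d        ≡⟨ %-+-cong (sym (m%n%n≡m%n c d)) (m%n%n≡m%n _ d) ⟩
    (c % d + (d + j ∸ c % d)) % d ≡⟨ cong (_% d) (m+[n∸m]≡n c%d≤d+j) ⟩
    (d + j) % d                  ≡⟨ %-remove-+ˡ j ∣-refl ⟩
    j % d                        ≡⟨ m<n⇒m%n≡m j<d ⟩
    j                            ∎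
    where
      open ≡-Reasoning
      c%d≤d+j : c % d ≤ d + j
      c%d≤d+j = ≤-trans (m%n≤n c d) (m≤m+n d j)

  modDiff-unique : ∀ {j} c {r} → j < d → r < d → (c + r) % d ≡ j → r ≡ modDiff j c
  modDiff-unique c {r} j<d r<d eq =
    +-cancelˡ-%-< c r<d (modDiff<d _ c) (trans eq (sym (+-modDiff-% c j<d)))

  [d+j∸i]%d≡j∸i : ∀ {i j} → i ≤ j → j < d → (d + j ∸ i) % d ≡ j ∸ i
  [d+j∸i]%d≡j∸i {i} {j} i≤j j<d = begin
    (d + j ∸ i) % d   ≡⟨ cong (_% d) (+-∸-assoc d i≤j) ⟩
    (d + (j ∸ i)) % d ≡⟨ %-remove-+ˡ (j ∸ i) ∣-refl ⟩
    (j ∸ i) % d       ≡⟨ m<n⇒m%n≡m (≤-<-trans (m∸n≤m j i) j<d) ⟩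
    j ∸ i             ∎
    where open ≡-Reasoning

  [d+j∸i]%d≡d+j∸i : ∀ {i j} → j < i → i < d → (d + j ∸ i) % d ≡ d + j ∸ i
  [d+j∸i]%d≡d+j∸i {i} {j} j<i i<d = m<n⇒m%n≡m (begin-strict
    d + j ∸ i       <⟨ ∸-monoʳ-< j<i (≤-trans (<⇒≤ i<d) (m≤m+n d j)) ⟩
    d + j ∸ j       ≡⟨ m+n∸n≡m d j ⟩
    d               ∎)
    where open ≤-Reasoning

  x≡d*[x/d]+x%d : ∀ x → x ≡ d * (x / d) + x % d
  x≡d*[x/d]+x%d x = trans (m≡m%n+[m/n]*n x d)
                     (trans (+-comm (x % d) _) (cong (_+ x % d) (*-comm (x / d) d)))

  [d*k+r]%d≡r : ∀ k {r} → r < d → (d * k + r) % d ≡ r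
  [d*k+r]%d≡r k {r} r<d = trans (%-remove-+ˡ r (m∣m*n k)) (m<n⇒m%n≡m r<d)

  [d*k+r]/d≡k : ∀ k {r} → r < d → (d * k + r) / d ≡ k
  [d*k+r]/d≡k k {r} r<d = begin
    (d * k + r) / d   ≡⟨ +-distrib-/-∣ˡ r (m∣m*n k) ⟩
    d * k / d + r / d ≡⟨ cong₂ _+_ (trans (/-congˡ (*-comm d k)) (m*n/n≡m k d)) (m<n⇒m/n≡0 r<d) ⟩
    k + 0             ≡⟨ +-identityʳ k ⟩
    k                 ∎
    where open ≡-Reasoning

module _ (d : ℕ) .{{_ : NonZero d}} (2≤d : 2 ≤ d) where

  sd-fuel-zero : ∀ f → sd-fuel f d 0 ≡ 0
  sd-fuel-zero zero    = refl
  sd-fuel-zero (suc f) = refl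

  sd-fuel-irrelevant : ∀ f g k → k ≤ f → k ≤ g → sd-fuel f d k ≡ sd-fuel g d k
  sd-fuel-irrelevant f g zero _ _ = trans (sd-fuel-zero f) (sym (sd-fuel-zero g))
  sd-fuel-irrelevant (suc f) (suc g) (suc k) (s≤s k≤f) (s≤s k≤g) =
    cong (suc k % d +_) (sd-fuel-irrelevant f g (suc k / d) (quotient≤ k≤f) (quotient≤ k≤g))
    where
      quotient≤ : ∀ {h} → k ≤ h → suc k / d ≤ h
      quotient≤ k≤h = ≤-trans (≤-pred (m/n<m (suc k) d 2≤d)) k≤h

  s-unfold : ∀ x → s d x ≡ x % d + s d (x / d)
  s-unfold zero    = sym (cong₂ (λ u v → u + s d v) (m<n⇒m%n≡m (>-nonZero⁻¹ d)) (0/n≡0 d))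
  s-unfold (suc y) = cong (suc y % d +_)
    (sd-fuel-irrelevant y (suc y / d) (suc y / d) (≤-pred (m/n<m (suc y) d 2≤d)) ≤-refl)

  s[d*k+r]≡s[k]+r : ∀ k {r} → r < d → s d (d * k + r) ≡ s d k + r
  s[d*k+r]≡s[k]+r k {r} r<d = begin
    s d (d * k + r)                           ≡⟨ s-unfold (d * k + r) ⟩
    (d * k + r) % d + s d ((d * k + r) / d)   ≡⟨ cong₂ (λ u v → u + s d v)
                                                   ([d*k+r]%d≡r d k r<d) ([d*k+r]/d≡k d k r<d) ⟩
    r + s d k                                 ≡⟨ +-comm r (s d k) ⟩
    s d k + r                                 ∎
    where open ≡-Reasoning

  enumerate : ℕ → ℕ → ℕ
  enumerate j m = d * m + modDiff d j (s d m)

  enumerate-strictMono : ∀ j m n → m < n → enumerate j m < enumerate j n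
  enumerate-strictMono j m n m<n = begin-strict
    d * m + modDiff d j (s d m) <⟨ +-monoʳ-< (d * m) (modDiff<d d j (s d m)) ⟩
    d * m + d                   ≡⟨ trans (+-comm (d * m) d) (sym (*-suc d m)) ⟩
    d * suc m                   ≤⟨ *-monoʳ-≤ d m<n ⟩
    d * n                       ≤⟨ m≤m+n (d * n) _ ⟩
    enumerate j n               ∎
    where open ≤-Reasoning

  s-enumerate : ∀ {j} m → j < d → s d (enumerate j m) % d ≡ j
  s-enumerate m j<d =
    trans (cong (_% d) (s[d*k+r]≡s[k]+r m (modDiff<d d _ (s d m)))) (+-modDiff-% d (s d m) j<d)

  enumerate-/ : ∀ {j} x → j < d → s d x % d ≡ j → enumerate j (x / d) ≡ x
  enumerate-/ {j} x j<d sx≡j = begin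
    d * (x / d) + modDiff d j (s d (x / d)) ≡⟨ cong (d * (x / d) +_) x%d≡modDiff ⟨
    d * (x / d) + x % d                     ≡⟨ x≡d*[x/d]+x%d d x ⟨
    x                                       ∎
    where
      open ≡-Reasoning
      x%d<d : x % d < d
      x%d<d = m%n<n x d
      x%d≡modDiff : x % d ≡ modDiff d j (s d (x / d))
      x%d≡modDiff = modDiff-unique d (s d (x / d)) j<d x%d<d (begin
        (s d (x / d) + x % d) % d   ≡⟨ cong (_% d) (s[d*k+r]≡s[k]+r (x / d) x%d<d) ⟨
        s d (d * (x / d) + x % d) % d ≡⟨ cong (λ y → s d y % d) (x≡d*[x/d]+x%d d x) ⟨
        s d x % d                   ≡⟨ sx≡j ⟩
        j                           ∎)

  enumerate-isIncreasingEnumeration : ∀ {j} → j < d →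
    IsIncreasingEnumeration (λ k → s d k % d ≡ j) (enumerate j)
  enumerate-isIncreasingEnumeration {j} j<d = enumerate-strictMono j , λ k → mk⇔
    (λ sk≡j → k / d , enumerate-/ k j<d sk≡j)
    (λ { (m , refl) → s-enumerate m j<d })

theorem2p4 : (d : ℕ) → .{{_ : NonZero d}} → 2 ≤ d → (a : ℕ → ℕ → ℕ) →
    (∀ j → j < d → IsIncreasingEnumeration (λ k → s d k % d ≡ j) (a j)) →
    ∀ n i j → i < d → j < d →
      (a j (a i n) ≡ d * a i n + (d + j ∸ i) % d)
      × (i ≤ j → a j (a i n) ≡ d * a i n + (j ∸ i))
      × (j < i → a j (a i n) ≡ d * a i n + (d + j ∸ i))
theorem2p4 d 2≤d a a-enum n i j i<d j<d =
  a-eq , (λ i≤j → trans a-eq (cong (d * m +_) ([d+j∸i]%d≡j∸i d i≤j j<d)))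
       , (λ j<i → trans a-eq (cong (d * m +_) ([d+j∸i]%d≡d+j∸i d j<i i<d)))
  where
    open ≡-Reasoning
    m = a i n
    s[m]%d≡i : s d m % d ≡ i
    s[m]%d≡i = Equivalence.from (proj₂ (a-enum i i<d) m) (n , refl)
    a-eq : a j m ≡ d * m + (d + j ∸ i) % d
    a-eq = begin
      a j m                          ≡⟨ isIncreasingEnumeration-unique (a-enum j j<d)
                                          (enumerate-isIncreasingEnumeration d 2≤d j<d) m ⟩
      d * m + modDiff d j (s d m)    ≡⟨ cong (λ c → d * m + (d + j ∸ c) % d) s[m]%d≡i ⟩
      d * m + (d + j ∸ i) % d        ∎
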